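{- Let $t\geq 3$ be an integer. If $(t^2-4)(4t^2+9)$ is a perfect square in $\mathbf{Z}$, then $t=3$. -}

module Defs where

-- With x = t², the product is 4x² − 7x − 36, which for x > 40 lies strictly between the
-- consecutive squares (2x − 2)² and (2x − 1)².  This leaves only t ∈ {3, 4, 5, 6}, and for
-- t = 4, 5, 6 the product 876, 2289, 4896 again falls strictly between consecutive squares.
module Submission where

open import Defs
open import Data.Integer using (ℤ; +_; _+_; _-_; _*_; _≤_; ∣_∣; +≤+)
open import Data.Integer.Properties using (abs-*; pos-*; [+m]-[+n]≡m⊖n; ⊖-≥)
open import Data.Nat as ℕ using (ℕ; suc; _∸_; _<_)
open import Data.Nat.Properties using (*-mono-≤; <⇒≤; <-≤-trans; ≤-<-trans; <-irrefl; ≰⇒>; m<m+n; <ᵇ⇒<)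
open import Data.Nat.Tactic.RingSolver using (solve-∀)
open import Data.Product using (∃; _,_)
open import Relation.Binary.PropositionalEquality using (_≡_; _≢_; refl; sym; cong; cong₂; trans; subst; module ≡-Reasoning)
open import Relation.Nullary using (yes; no)
open import Data.Empty using (⊥-elim)

-- Q (t * t) is the product of the theorem; the truncated subtraction is exact once t ≥ 2.
Q : ℕ → ℕ
Q x = (x ∸ 4) ℕ.* (4 ℕ.* x ℕ.+ 9)

square-not-strictly-between : ∀ a {c} m → a ℕ.* a < c → c < suc a ℕ.* suc a → m ℕ.* m ≢ c
square-not-strictly-between a m lo hi refl with m ℕ.≤? a
... | yes m≤a = <-irrefl refl (≤-<-trans (*-mono-≤ m≤a m≤a) lo)
... | no  m≰a = <-irrefl refl (<-≤-trans hi (*-mono-≤ (≰⇒> m≰a) (≰⇒> m≰a)))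

-- With x = 41 + z: Q x = (2x − 2)² + (x − 40) = (2x − 1)² − (3x + 37).  The ring solver cannot
-- see through ∸, so each identity is proved with (41 + z) ∸ 4 already reduced to 37 + z.
Q-above-lower-square : ∀ z → (80 ℕ.+ 2 ℕ.* z) ℕ.* (80 ℕ.+ 2 ℕ.* z) ℕ.+ suc z ≡ Q (41 ℕ.+ z)
Q-above-lower-square = identity
  where
  identity : ∀ z → (80 ℕ.+ 2 ℕ.* z) ℕ.* (80 ℕ.+ 2 ℕ.* z) ℕ.+ suc z ≡ (37 ℕ.+ z) ℕ.* (4 ℕ.* (41 ℕ.+ z) ℕ.+ 9)
  identity = solve-∀

Q-below-upper-square : ∀ z → Q (41 ℕ.+ z) ℕ.+ (160 ℕ.+ 3 ℕ.* z) ≡ (81 ℕ.+ 2 ℕ.* z) ℕ.* (81 ℕ.+ 2 ℕ.* z)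
Q-below-upper-square = identity
  where
  identity : ∀ z → (37 ℕ.+ z) ℕ.* (4 ℕ.* (41 ℕ.+ z) ℕ.+ 9) ℕ.+ (160 ℕ.+ 3 ℕ.* z) ≡ (81 ℕ.+ 2 ℕ.* z) ℕ.* (81 ℕ.+ 2 ℕ.* z)
  identity = solve-∀

Q-not-square-above-40 : ∀ z m → m ℕ.* m ≢ Q (41 ℕ.+ z)
Q-not-square-above-40 z m = square-not-strictly-between a m
  (subst (a ℕ.* a <_) (Q-above-lower-square z) (m<m+n (a ℕ.* a) (ℕ.s≤s ℕ.z≤n)))
  (subst (Q (41 ℕ.+ z) <_) (Q-below-upper-square z) (m<m+n (Q (41 ℕ.+ z)) (ℕ.s≤s ℕ.z≤n)))
  where
  a = 80 ℕ.+ 2 ℕ.* z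

square-shift : ∀ i → (7 ℕ.+ i) ℕ.* (7 ℕ.+ i) ≡ 41 ℕ.+ (8 ℕ.+ 14 ℕ.* i ℕ.+ i ℕ.* i)
square-shift = solve-∀

Q-square⇒3 : ∀ n → 3 ℕ.≤ n → ∀ m → m ℕ.* m ≡ Q (n ℕ.* n) → n ≡ 3
Q-square⇒3 0 () _ _
Q-square⇒3 1 (ℕ.s≤s ()) _ _
Q-square⇒3 2 (ℕ.s≤s (ℕ.s≤s ())) _ _
Q-square⇒3 3 _ _ _ = refl
Q-square⇒3 4 _ m m²≡Q = ⊥-elim (square-not-strictly-between 29 m (<ᵇ⇒< _ _ _) (<ᵇ⇒< _ _ _) m²≡Q)
Q-square⇒3 5 _ m m²≡Q = ⊥-elim (square-not-strictly-between 47 m (<ᵇ⇒< _ _ _) (<ᵇ⇒< _ _ _) m²≡Q)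
Q-square⇒3 6 _ m m²≡Q = ⊥-elim (square-not-strictly-between 69 m (<ᵇ⇒< _ _ _) (<ᵇ⇒< _ _ _) m²≡Q)
Q-square⇒3 (suc (suc (suc (suc (suc (suc (suc i))))))) _ m m²≡Q =
  ⊥-elim (Q-not-square-above-40 (8 ℕ.+ 14 ℕ.* i ℕ.+ i ℕ.* i) m (subst (λ x → m ℕ.* m ≡ Q x) (square-shift i) m²≡Q))

∣product∣≡Q : ∀ n → 2 ℕ.≤ n → ∣ (+ n * + n - + 4) * (+ 4 * (+ n * + n) + + 9) ∣ ≡ Q (n ℕ.* n)
∣product∣≡Q n 2≤n = begin
  ∣ (+ n * + n - + 4) * (+ 4 * (+ n * + n) + + 9) ∣  ≡⟨ cong (λ x → ∣ (x - + 4) * (+ 4 * x + + 9) ∣) (sym (pos-* n n)) ⟩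
  ∣ (+ x - + 4) * (+ 4 * + x + + 9) ∣                ≡⟨ abs-* (+ x - + 4) (+ 4 * + x + + 9) ⟩
  ∣ + x - + 4 ∣ ℕ.* ∣ + 4 * + x + + 9 ∣              ≡⟨ cong₂ ℕ._*_ (cong ∣_∣ x-4) (cong (λ y → ∣ y + + 9 ∣) (sym (pos-* 4 x))) ⟩
  Q x                                                ∎
  where
  open ≡-Reasoning
  x = n ℕ.* n
  x-4 : + x - + 4 ≡ + (x ∸ 4)
  x-4 = trans ([+m]-[+n]≡m⊖n x 4) (⊖-≥ (*-mono-≤ 2≤n 2≤n))

mainTheorem4 : (t : ℤ) → + 3 ≤ t →
    ∃ (λ (k : ℤ) → k * k ≡ (t * t - + 4) * (+ 4 * (t * t) + + 9)) →
    t ≡ + 3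
mainTheorem4 (+ n) (+≤+ 3≤n) (k , k²≡product) = cong +_ (Q-square⇒3 n 3≤n ∣ k ∣ ∣k∣²≡Q)
  where
  open ≡-Reasoning
  ∣k∣²≡Q : ∣ k ∣ ℕ.* ∣ k ∣ ≡ Q (n ℕ.* n)
  ∣k∣²≡Q = begin
    ∣ k ∣ ℕ.* ∣ k ∣                                    ≡⟨ sym (abs-* k k) ⟩
    ∣ k * k ∣                                          ≡⟨ cong ∣_∣ k²≡product ⟩
    ∣ (+ n * + n - + 4) * (+ 4 * (+ n * + n) + + 9) ∣  ≡⟨ ∣product∣≡Q n (<⇒≤ 3≤n) ⟩
    Q (n ℕ.* n)                                        ∎
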